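{- Let $G$ be a finite simple graph with $n$ vertices, let $\mathcal{V}_G\cong\mathbf{Z}_2^n$ be its state space and $a$ its harmonic operator. Let $k\ge 0$ and $m\ge 1$ be the smallest integers with $a^{k+m}=a^k$, and put $p=|L(a)|\cdot|T(a)|=m\cdot k$. Then $\pi=a^p$ is an orthogonal projection of $\mathcal{V}_G$, i.e. $\pi^2=\pi$ and $\pi$ is self-adjoint with respect to the standard bilinear form $g(v_i,v_j)=\delta_{ij}$ (equivalently $\pi^T=\pi$).
   Context: $G$ is a finite simple graph with vertex set $\{v_1,\dots,v_n\}$. A state is a subset of the vertex set; the set $\mathcal{V}_G$ of states is a vector space over $\mathbf{Z}_2$ under symmetric difference, identified with $\mathbf{Z}_2^n$ via the basis of single vertices. The harmonic operator $a:\mathcal{V}_G\to\mathcal{V}_G$ is the $\mathbf{Z}_2$-linear map whose matrix in the vertex basis is $A+D \pmod 2$, where $A$ is the adjacency matrix and $D$ is diagonal with $D_{ii}=1$ iff $v_i$ has odd degree (the graph Laplacian mod 2). The monoid generated by $a$ is $\{1,a,\dots,a^{k+m-1}\}$ with $a^{k+m}=a^k$ ($k,m$ minimal); the paper writes $T(a)$ for the tail part, with $|T(a)|=k$, and $L(a)=\{a^k,\dots,a^{k+m-1}\}$ for the cyclic group part, with $|L(a)|=m$. -}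

module Defs where

open import Data.Nat using (ℕ; zero; suc)
open import Data.Fin using (Fin; zero; suc; _≟_)
open import Data.Bool using (Bool; true; false; _xor_; _∧_)
open import Relation.Nullary.Decidable using (⌊_⌋)
open import Relation.Binary.PropositionalEquality using (_≡_)

record SimpleGraph (n : ℕ) : Set where
  field
    adj     : Fin n → Fin n → Bool
    symm    : ∀ i j → adj i j ≡ adj j i
    irrefl  : ∀ i → adj i i ≡ false
open SimpleGraph public

-- Square matrices over Z₂ = Bool (addition = xor, multiplication = ∧).
Mat : ℕ → Set
Mat n = Fin n → Fin n → Bool

⊕Σ : ∀ {n} → (Fin n → Bool) → Bool
⊕Σ {zero}  f = false
⊕Σ {suc n} f = f zero xor ⊕Σ (λ i → f (suc i))

_≈M_ : ∀ {n} → Mat n → Mat n → Set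
M ≈M N = ∀ i j → M i j ≡ N i j

_·M_ : ∀ {n} → Mat n → Mat n → Mat n
(M ·M N) i j = ⊕Σ (λ l → M i l ∧ N l j)

idM : ∀ {n} → Mat n
idM i j = ⌊ i ≟ j ⌋

transpose : ∀ {n} → Mat n → Mat n
transpose M i j = M j i

_^M_ : ∀ {n} → Mat n → ℕ → Mat n
M ^M zero  = idM
M ^M suc k = M ·M (M ^M k)

oddDegree : ∀ {n} → SimpleGraph n → Fin n → Bool
oddDegree G i = ⊕Σ (adj G i)

harmonic : ∀ {n} → SimpleGraph n → Mat n
harmonic G i j = adj G i j xor (⌊ i ≟ j ⌋ ∧ oddDegree G i)

-- The mod-2 Laplacian a is symmetric, hence so is every power of it.  For
-- j ≥ k the relation a^(k+m) = a^k gives a^(j+m) = a^j, so a^(j+mt) = a^j.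
module Submission where

open import Defs
open import Data.Nat using (ℕ; zero; suc; _+_; _*_; _≤_; _∸_; >-nonZero)
open import Data.Nat.Properties
  using (+-assoc; +-comm; +-identityʳ; *-zeroʳ; ≤-trans; m≤m+n; m≤n*m; m∸n+n≡m)
open import Data.Nat.Tactic.RingSolver using (solve-∀)
open import Data.Product using (_×_; _,_)
open import Data.Fin using (Fin; zero; suc; _≟_)
open import Data.Bool using (Bool; false; _xor_; _∧_)
open import Data.Bool.Properties
  using (xor-∧-commutativeRing; xor-identityʳ; ∧-comm; ∧-assoc; ∧-zeroʳ; ∧-distribˡ-xor)
open import Algebra.Bundles using (CommutativeRing)
open import Algebra.Properties.CommutativeSemigroup
  (CommutativeRing.+-commutativeSemigroup xor-∧-commutativeRing) using (interchange)
open import Relation.Nullary using (yes; no; contradiction)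
open import Relation.Nullary.Decidable using (⌊_⌋)
open import Level using (0ℓ)
open import Relation.Binary.Bundles using (Setoid)
open import Relation.Binary.PropositionalEquality
  using (_≡_; refl; sym; trans; cong; cong₂; module ≡-Reasoning)
import Relation.Binary.Reasoning.Setoid as SetoidReasoning

⊕Σ-cong : ∀ {n} {f g : Fin n → Bool} → (∀ i → f i ≡ g i) → ⊕Σ f ≡ ⊕Σ g
⊕Σ-cong {zero}  e = refl
⊕Σ-cong {suc n} e = cong₂ _xor_ (e zero) (⊕Σ-cong (λ i → e (suc i)))

⊕Σ-false : ∀ {n} → ⊕Σ {n} (λ _ → false) ≡ false
⊕Σ-false {zero}  = refl
⊕Σ-false {suc n} = ⊕Σ-false {n}

⊕Σ-xor : ∀ {n} (f g : Fin n → Bool) → ⊕Σ (λ i → f i xor g i) ≡ ⊕Σ f xor ⊕Σ g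
⊕Σ-xor {zero}  f g = refl
⊕Σ-xor {suc n} f g =
  trans (cong ((f zero xor g zero) xor_) (⊕Σ-xor (λ i → f (suc i)) (λ i → g (suc i))))
        (interchange (f zero) (g zero) _ _)

∧-distribˡ-⊕Σ : ∀ {n} b (f : Fin n → Bool) → b ∧ ⊕Σ f ≡ ⊕Σ (λ i → b ∧ f i)
∧-distribˡ-⊕Σ {zero}  b f = ∧-zeroʳ b
∧-distribˡ-⊕Σ {suc n} b f =
  trans (∧-distribˡ-xor b (f zero) _) (cong ((b ∧ f zero) xor_) (∧-distribˡ-⊕Σ b (λ i → f (suc i))))

∧-distribʳ-⊕Σ : ∀ {n} b (f : Fin n → Bool) → ⊕Σ f ∧ b ≡ ⊕Σ (λ i → f i ∧ b)
∧-distribʳ-⊕Σ b f =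
  trans (∧-comm (⊕Σ f) b) (trans (∧-distribˡ-⊕Σ b f) (⊕Σ-cong (λ i → ∧-comm b (f i))))

⊕Σ-comm : ∀ {n m} (f : Fin n → Fin m → Bool) →
          ⊕Σ (λ i → ⊕Σ (λ j → f i j)) ≡ ⊕Σ (λ j → ⊕Σ (λ i → f i j))
⊕Σ-comm {zero}  {m} f = sym (⊕Σ-false {m})
⊕Σ-comm {suc n} {m} f =
  trans (cong (⊕Σ (f zero) xor_) (⊕Σ-comm (λ i → f (suc i))))
        (sym (⊕Σ-xor (f zero) (λ j → ⊕Σ (λ i → f (suc i) j))))

δ-sym : ∀ {n} (i j : Fin n) → ⌊ i ≟ j ⌋ ≡ ⌊ j ≟ i ⌋
δ-sym i j with i ≟ j | j ≟ i
... | yes _   | yes _   = refl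
... | no _    | no _    = refl
... | yes i≡j | no j≢i  = contradiction (sym i≡j) j≢i
... | no i≢j  | yes j≡i = contradiction (sym j≡i) i≢j

δ-suc : ∀ {n} (i j : Fin n) → ⌊ suc i ≟ suc j ⌋ ≡ ⌊ i ≟ j ⌋
δ-suc i j with i ≟ j
... | yes _ = refl
... | no _  = refl

⊕Σ-δ : ∀ {n} (i : Fin n) (f : Fin n → Bool) → ⊕Σ (λ l → ⌊ i ≟ l ⌋ ∧ f l) ≡ f i
⊕Σ-δ {suc n} zero    f = trans (cong (f zero xor_) (⊕Σ-false {n})) (xor-identityʳ _)
⊕Σ-δ {suc n} (suc i) f =
  trans (⊕Σ-cong (λ l → cong (_∧ f (suc l)) (δ-suc i l))) (⊕Σ-δ i (λ l → f (suc l)))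

≈M-setoid : ℕ → Setoid 0ℓ 0ℓ
≈M-setoid n = record
  { Carrier       = Mat n
  ; _≈_           = _≈M_
  ; isEquivalence = record
    { refl  = λ _ _ → refl
    ; sym   = λ A≈B i j → sym (A≈B i j)
    ; trans = λ A≈B B≈C i j → trans (A≈B i j) (B≈C i j)
    }
  }

module _ {n : ℕ} where

  open Setoid (≈M-setoid n) using ()
    renaming (refl to ≈M-refl; sym to ≈M-sym; reflexive to ≈M-reflexive)

  ·M-cong : {A A′ B B′ : Mat n} → A ≈M A′ → B ≈M B′ → (A ·M B) ≈M (A′ ·M B′)
  ·M-cong A≈A′ B≈B′ i j = ⊕Σ-cong (λ l → cong₂ _∧_ (A≈A′ i l) (B≈B′ l j))

  ·M-assoc : (A B C : Mat n) → ((A ·M B) ·M C) ≈M (A ·M (B ·M C))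
  ·M-assoc A B C i j = begin
    ⊕Σ (λ l → ⊕Σ (λ q → A i q ∧ B q l) ∧ C l j)    ≡⟨ ⊕Σ-cong {n} (λ l → ∧-distribʳ-⊕Σ (C l j) (λ q → A i q ∧ B q l)) ⟩
    ⊕Σ (λ l → ⊕Σ (λ q → (A i q ∧ B q l) ∧ C l j)) ≡⟨ ⊕Σ-comm (λ l q → (A i q ∧ B q l) ∧ C l j) ⟩
    ⊕Σ (λ q → ⊕Σ (λ l → (A i q ∧ B q l) ∧ C l j)) ≡⟨ ⊕Σ-cong {n} (λ q → ⊕Σ-cong {n} (λ l → ∧-assoc (A i q) (B q l) (C l j))) ⟩
    ⊕Σ (λ q → ⊕Σ (λ l → A i q ∧ (B q l ∧ C l j))) ≡⟨ ⊕Σ-cong {n} (λ q → ∧-distribˡ-⊕Σ (A i q) (λ l → B q l ∧ C l j)) ⟨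
    ⊕Σ (λ q → A i q ∧ ⊕Σ (λ l → B q l ∧ C l j))   ∎
    where open ≡-Reasoning

  ·M-identityˡ : (A : Mat n) → (idM ·M A) ≈M A
  ·M-identityˡ A i j = ⊕Σ-δ i (λ l → A l j)

  ·M-identityʳ : (A : Mat n) → (A ·M idM) ≈M A
  ·M-identityʳ A i j =
    trans (⊕Σ-cong (λ l → trans (∧-comm (A i l) _) (cong (_∧ A i l) (δ-sym l j)))) (⊕Σ-δ j (A i))

  transpose-idM : transpose (idM {n}) ≈M idM
  transpose-idM i j = δ-sym j i

  transpose-·M : (A B : Mat n) → transpose (A ·M B) ≈M (transpose B ·M transpose A)
  transpose-·M A B i j = ⊕Σ-cong (λ l → ∧-comm (A j l) (B l i))

  module _ (M : Mat n) where

    open SetoidReasoning (≈M-setoid n)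

    ^M-+ : ∀ a b → (M ^M (a + b)) ≈M ((M ^M a) ·M (M ^M b))
    ^M-+ zero    b = ≈M-sym (·M-identityˡ (M ^M b))
    ^M-+ (suc a) b = begin
      M ·M (M ^M (a + b))          ≈⟨ ·M-cong ≈M-refl (^M-+ a b) ⟩
      M ·M ((M ^M a) ·M (M ^M b))  ≈⟨ ·M-assoc M (M ^M a) (M ^M b) ⟨
      (M ·M (M ^M a)) ·M (M ^M b)  ∎

    ^M-·M-comm : ∀ k → ((M ^M k) ·M M) ≈M (M ^M suc k)
    ^M-·M-comm k = begin
      (M ^M k) ·M M              ≈⟨ ·M-cong ≈M-refl (·M-identityʳ M) ⟨
      (M ^M k) ·M (M ^M 1)       ≈⟨ ^M-+ k 1 ⟨
      M ^M (k + 1)               ≡⟨ cong (M ^M_) (+-comm k 1) ⟩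
      M ^M suc k                 ∎

    transpose-^M : transpose M ≈M M → ∀ k → transpose (M ^M k) ≈M (M ^M k)
    transpose-^M Mᵀ≈M zero    = transpose-idM
    transpose-^M Mᵀ≈M (suc k) = begin
      transpose (M ·M (M ^M k))        ≈⟨ transpose-·M M (M ^M k) ⟩
      transpose (M ^M k) ·M transpose M ≈⟨ ·M-cong (transpose-^M Mᵀ≈M k) Mᵀ≈M ⟩
      (M ^M k) ·M M                     ≈⟨ ^M-·M-comm k ⟩
      M ^M suc k                        ∎

    module _ {k m : ℕ} (period : (M ^M (k + m)) ≈M (M ^M k)) where

      ^M-+-period : ∀ {j} → k ≤ j → (M ^M (j + m)) ≈M (M ^M j)
      ^M-+-period {j} k≤j = begin
        M ^M (j + m)                      ≡⟨ cong (λ e → M ^M (e + m)) (m∸n+n≡m k≤j) ⟨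
        M ^M ((j ∸ k + k) + m)            ≡⟨ cong (M ^M_) (+-assoc (j ∸ k) k m) ⟩
        M ^M (j ∸ k + (k + m))            ≈⟨ ^M-+ (j ∸ k) (k + m) ⟩
        (M ^M (j ∸ k)) ·M (M ^M (k + m))  ≈⟨ ·M-cong ≈M-refl period ⟩
        (M ^M (j ∸ k)) ·M (M ^M k)        ≈⟨ ^M-+ (j ∸ k) k ⟨
        M ^M (j ∸ k + k)                  ≡⟨ cong (M ^M_) (m∸n+n≡m k≤j) ⟩
        M ^M j                            ∎

      ^M-+-multiple-of-period : ∀ {j} → k ≤ j → ∀ t → (M ^M (j + m * t)) ≈M (M ^M j)
      ^M-+-multiple-of-period {j} k≤j zero =
        ≈M-reflexive (cong (M ^M_) (trans (cong (j +_) (*-zeroʳ m)) (+-identityʳ j)))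
      ^M-+-multiple-of-period {j} k≤j (suc t) = begin
        M ^M (j + m * suc t)   ≡⟨ cong (M ^M_) (j+m*[1+t]≡j+m*t+m j m t) ⟩
        M ^M (j + m * t + m)   ≈⟨ ^M-+-period (≤-trans k≤j (m≤m+n j (m * t))) ⟩
        M ^M (j + m * t)       ≈⟨ ^M-+-multiple-of-period k≤j t ⟩
        M ^M j                 ∎
        where
        j+m*[1+t]≡j+m*t+m : ∀ j m t → j + m * suc t ≡ j + m * t + m
        j+m*[1+t]≡j+m*t+m = solve-∀

      ^M-idempotent : 1 ≤ m → ((M ^M (m * k)) ·M (M ^M (m * k))) ≈M (M ^M (m * k))
      ^M-idempotent 1≤m = begin
        (M ^M (m * k)) ·M (M ^M (m * k))  ≈⟨ ^M-+ (m * k) (m * k) ⟨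
        M ^M (m * k + m * k)              ≈⟨ ^M-+-multiple-of-period (m≤n*m k m {{>-nonZero 1≤m}}) k ⟩
        M ^M (m * k)                      ∎

harmonic-symmetric : ∀ {n} (G : SimpleGraph n) → transpose (harmonic G) ≈M harmonic G
harmonic-symmetric G i j with i ≟ j | j ≟ i
... | yes refl | yes _    = refl
... | no _     | no _     = cong (_xor false) (symm G j i)
... | yes i≡j  | no j≢i   = contradiction (sym i≡j) j≢i
... | no i≢j   | yes j≡i  = contradiction (sym j≡i) i≢j

lemma1 : ∀ {n} (G : SimpleGraph n) (k m : ℕ)
    → 1 ≤ m
    → (harmonic G ^M (k + m)) ≈M (harmonic G ^M k)
    → (∀ k' m' → 1 ≤ m' → (harmonic G ^M (k' + m')) ≈M (harmonic G ^M k') → k ≤ k' × m ≤ m')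
    → (((harmonic G ^M (m * k)) ·M (harmonic G ^M (m * k))) ≈M (harmonic G ^M (m * k)))
      × (transpose (harmonic G ^M (m * k)) ≈M (harmonic G ^M (m * k)))
lemma1 G k m 1≤m period _ =
  ^M-idempotent (harmonic G) period 1≤m , transpose-^M (harmonic G) (harmonic-symmetric G) (m * k)
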